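{- Let $\Gamma$ be the Coxeter graph, regarded as a digraph. Then $\Gamma$ is a $\{\vec{C}_7\}_{\vec{P}_3}$-UH digraph.
   Context: The Coxeter graph $\Gamma$ is the cubic graph on $28$ vertices $u_x, v_x, t_x, z_x$ ($x\in\mathbb{Z}_7$) with the following edges. The three $7$-cycles $(u_1u_2u_3u_4u_5u_6u_0)$, $(v_4v_6v_1v_3v_5v_0v_2)$, $(t_3t_6t_2t_5t_1t_4t_0)$, where consecutive vertices are adjacent and the last vertex is adjacent to the first. In addition, for each $x\in\mathbb{Z}_7$, the vertex $z_x$ is adjacent to $u_x, v_x, t_x$. A graph is regarded as a digraph by replacing each edge $\{u,v\}$ by the two oppositely oriented arcs $(u,v)$ and $(v,u)$. $\vec{C}_7$ denotes the oriented $7$-cycle, and $\vec{P}_3$ the directed path with $3$ vertices (a $2$-arc). For a digraph $\vec{H}$, a digraph $G$ is $\vec{H}$-UH if every isomorphism between two copies of $\vec{H}$ in $G$ extends to an automorphism of $G$. For a subdigraph $\vec{M}$ of $\vec{H}$, the graph $G$ is a $\{\vec{H}\}_{\vec{M}}$-UH digraph if all of the following hold: - $G$ is both $\vec{M}$-UH and $\vec{H}$-UH; - for every copy $\vec{H}_0$ of $\vec{H}$ in $G$ and every copy $\vec{M}_0$ of $\vec{M}$ contained in $\vec{H}_0$, there is exactly one copy $\vec{H}_1\neq\vec{H}_0$ of $\vec{H}$ in $G$ with $V(\vec{H}_0)\cap V(\vec{H}_1)=V(\vec{M}_0)$ and $A(\vec{H}_0)\cap \bar{A}(\vec{H}_1)=A(\vec{M}_0)$.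 Here $A(\cdot)$ is the arc set, and $\bar{A}(\vec{H}_1)=\{(w,u): (u,w)\in A(\vec{H}_1)\}$ is the set of reversed arcs of $\vec{H}_1$. -}

module Defs where

open import Data.Nat using (ℕ; suc; _+_)
open import Data.Nat.DivMod using (_mod_)
open import Data.Fin using (Fin; toℕ)
open import Data.Product using (Σ; ∃; ∃₂; _×_; _,_)
open import Data.Sum using (_⊎_)
open import Relation.Binary.PropositionalEquality using (_≡_)
open import Relation.Nullary using (¬_)

record Digraph : Set₁ where
  field
    Vtx : Set
    Arc : Vtx → Vtx → Set

open Digraph public

_⇔′_ : Set → Set → Set
P ⇔′ Q = (P → Q) × (Q → P)

data Kind : Set where
  u v t z : Kind

CoxV : Set
CoxV = Kind × Fin 7

_+₇_ : Fin 7 → ℕ → Fin 7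
i +₇ k = (toℕ i + k) mod 7

-- the (undirected) edges, each listed once
data CoxEdge : CoxV → CoxV → Set where
  uu : ∀ i → CoxEdge (u , i) (u , i +₇ 1)   -- (u1 u2 u3 u4 u5 u6 u0)
  vv : ∀ i → CoxEdge (v , i) (v , i +₇ 2)   -- (v4 v6 v1 v3 v5 v0 v2)
  tt : ∀ i → CoxEdge (t , i) (t , i +₇ 3)   -- (t3 t6 t2 t5 t1 t4 t0)
  zu : ∀ i → CoxEdge (z , i) (u , i)
  zv : ∀ i → CoxEdge (z , i) (v , i)
  zt : ∀ i → CoxEdge (z , i) (t , i)

Coxeter : Digraph
Coxeter = record
  { Vtx = CoxV
  ; Arc = λ a b → CoxEdge a b ⊎ CoxEdge b a
  }

C⃗₇ : Digraph
C⃗₇ = record { Vtx = Fin 7 ; Arc = λ i j → j ≡ i +₇ 1 }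

P⃗₃ : Digraph
P⃗₃ = record { Vtx = Fin 3 ; Arc = λ i j → toℕ j ≡ suc (toℕ i) }

-- A copy is the subdigraph of G that is the image of
-- an injective homomorphism H → G (vertex set = image of the vertices,
-- arc set = image of the arcs); it is isomorphic to H via the map.

record Copy (G H : Digraph) : Set where
  field
    emb : Vtx H → Vtx G
    inj : ∀ i j → emb i ≡ emb j → i ≡ j
    hom : ∀ i j → Arc H i j → Arc G (emb i) (emb j)

open Copy public

module _ {G H : Digraph} where

  InV : Copy G H → Vtx G → Set
  InV c x = ∃ λ i → emb c i ≡ x

  InA : Copy G H → Vtx G → Vtx G → Set
  InA c a b = ∃₂ λ i j → Arc H i j × emb c i ≡ a × emb c j ≡ b

  SameCopy : Copy G H → Copy G H → Set
  SameCopy c d = (∀ x → InV c x ⇔′ InV d x) × (∀ a b → InA c a b ⇔′ InA d a b)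

  record IsIso (c d : Copy G H) (φ : Vtx G → Vtx G) : Set where
    field
      maps : ∀ x → InV c x → InV d (φ x)
      injV : ∀ x y → InV c x → InV c y → φ x ≡ φ y → x ≡ y
      surj : ∀ y → InV d y → ∃ λ x → InV c x × φ x ≡ y
      arcs : ∀ a b → InV c a → InV c b → InA c a b ⇔′ InA d (φ a) (φ b)

record Aut (G : Digraph) : Set where
  field
    σ    : Vtx G → Vtx G
    σ⁻¹  : Vtx G → Vtx G
    invˡ : ∀ x → σ⁻¹ (σ x) ≡ x
    invʳ : ∀ x → σ (σ⁻¹ x) ≡ x
    pres : ∀ a b → Arc G a b ⇔′ Arc G (σ a) (σ b)

UH : Digraph → Digraph → Set
UH G H = (c d : Copy G H) (φ : Vtx G → Vtx G) → IsIso c d φ →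
         Σ (Aut G) λ α → ∀ x → InV c x → Aut.σ α x ≡ φ x

_⊑_ : {G H M : Digraph} → Copy G M → Copy G H → Set
M₀ ⊑ H₀ = (∀ x → InV M₀ x → InV H₀ x) × (∀ a b → InA M₀ a b → InA H₀ a b)

Partner : {G H M : Digraph} → Copy G H → Copy G M → Copy G H → Set
Partner H₀ M₀ H₁ =
  ¬ SameCopy H₀ H₁ ×
  (∀ x → (InV H₀ x × InV H₁ x) ⇔′ InV M₀ x) ×
  (∀ a b → (InA H₀ a b × InA H₁ b a) ⇔′ InA M₀ a b)

SetUH : Digraph → Digraph → Digraph → Set
SetUH G H M =
  UH G M × UH G H ×
  ((H₀ : Copy G H) (M₀ : Copy G M) → M₀ ⊑ H₀ →
     Σ (Copy G H) λ H₁ → Partner H₀ M₀ H₁ ×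
       ((H₂ : Copy G H) → Partner H₀ M₀ H₂ → SameCopy H₁ H₂))

-- Aut Γ contains the rotation ρ, the reflection ι, the map μ multiplying indices by 2 (which permutes
-- the u-, v- and t-cycles) and an involution κ fixing the 2-arc u₀u₁u₂; composing them along the
-- stabiliser chain of a 3-arc gives an automorphism moving any 2-arc, resp. 3-arc, onto u₀u₁u₂,
-- resp. u₀u₁u₂u₃ (checked exhaustively).  A closed 7-walk starting with u₀u₁u₂u₃ is the u-cycle,
-- so Aut Γ is transitive on labelled copies of P⃗₃ and of C⃗₇.  Since an isomorphism between two
-- copies of a digraph H is induced by an automorphism of H, this transitivity gives
-- ultrahomogeneity.  For the partner condition, move the 7-cycle and its 2-arc onto u₀…u₆ and
-- u₀u₁u₂: a partner must then contain the reversed 2-arc u₂u₁u₀ and no other vertex of the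
-- u-cycle, and the only such 7-cycle is u₂u₁u₀z₀v₀v₂z₂.

module Submission where

open import Defs
open import Data.Bool using (if_then_else_)
open import Data.Fin as Fin using (Fin; toℕ; #_)
import Data.Fin.Properties as Fin
open import Data.List using (List; []; _∷_)
open import Data.Nat as ℕ using (ℕ; zero; suc; _∸_)
open import Data.Nat.DivMod using (_mod_)
open import Data.Product using (Σ; ∃; _×_; _,_; proj₁; proj₂)
open import Data.Product.Properties using (≡-dec)
open import Data.Sum using (inj₁; inj₂; [_,_]′)
open import Data.Vec using (Vec; lookup) renaming (_∷_ to _∷ᵥ_; [] to []ᵥ)
open import Function using (case_of_)
open import Level using (0ℓ)
open import Relation.Binary.Bundles using (Setoid)
open import Relation.Binary.Definitions using (DecidableEquality)
open import Relation.Binary.PropositionalEquality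
import Relation.Binary.Reasoning.Setoid as SetoidReasoning
open import Relation.Nullary using (¬_; Dec; yes; no; does)
open import Relation.Nullary.Decidable using (map′; from-yes; _×-dec_; _⊎-dec_; _→-dec_; ¬?)
import Relation.Unary as U

private
  variable
    A B C D : Set
    G H M : Digraph

_×-⇔′_ : A ⇔′ B → C ⇔′ D → (A × C) ⇔′ (B × D)
(f , g) ×-⇔′ (h , k) = (λ { (a , c) → f a , h c }) , (λ { (b , d) → g b , k d })

⇔′-refl : A ⇔′ A
⇔′-refl = (λ a → a) , (λ a → a)

⇔′-sym : A ⇔′ B → B ⇔′ A
⇔′-sym (f , g) = g , f

⇔′-trans : A ⇔′ B → B ⇔′ C → A ⇔′ C
⇔′-trans (f , g) (h , k) = (λ a → h (f a)) , (λ c → g (k c))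

_⇔′?_ : Dec A → Dec B → Dec (A ⇔′ B)
a? ⇔′? b? = (a? →-dec b?) ×-dec (b? →-dec a?)

open Aut

infixr 9 _∘ᴬ_
infix 10 _^ᴬ_
infix 11 _⁻¹ᴬ

idᴬ : Aut G
idᴬ = record
  { σ = λ x → x ; σ⁻¹ = λ x → x ; invˡ = λ _ → refl ; invʳ = λ _ → refl
  ; pres = λ _ _ → (λ r → r) , (λ r → r) }

_∘ᴬ_ : Aut G → Aut G → Aut G
α ∘ᴬ β = record
  { σ = λ x → σ α (σ β x)
  ; σ⁻¹ = λ x → σ⁻¹ β (σ⁻¹ α x)
  ; invˡ = λ x → trans (cong (σ⁻¹ β) (invˡ α (σ β x))) (invˡ β x)
  ; invʳ = λ x → trans (cong (σ α) (invʳ β (σ⁻¹ α x))) (invʳ α x)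
  ; pres = λ a b → ⇔′-trans (pres β a b) (pres α (σ β a) (σ β b)) }

_⁻¹ᴬ : Aut G → Aut G
_⁻¹ᴬ {G = G} α = record
  { σ = σ⁻¹ α ; σ⁻¹ = σ α ; invˡ = invʳ α ; invʳ = invˡ α
  ; pres = λ a b → ⇔′-sym (subst₂ (λ x y → Arc G (σ⁻¹ α a) (σ⁻¹ α b) ⇔′ Arc G x y)
                                  (invʳ α a) (invʳ α b) (pres α (σ⁻¹ α a) (σ⁻¹ α b))) }

_^ᴬ_ : Aut G → ℕ → Aut G
α ^ᴬ zero  = idᴬ
α ^ᴬ suc n = α ∘ᴬ α ^ᴬ n

σ-injective : (α : Aut G) {x y : Vtx G} → σ α x ≡ σ α y → x ≡ y
σ-injective α {x} {y} e = trans (sym (invˡ α x)) (trans (cong (σ⁻¹ α) e) (invˡ α y))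

σ⁻¹-from : (α : Aut G) {x y : Vtx G} → σ α x ≡ y → σ⁻¹ α y ≡ x
σ⁻¹-from α {x} refl = invˡ α x

record FiniteDigraph (G : Digraph) : Set₁ where
  field
    all? : {P : Vtx G → Set} → U.Decidable P → Dec (∀ x → P x)
    any? : {P : Vtx G → Set} → U.Decidable P → Dec (∃ P)
    _≟_  : DecidableEquality (Vtx G)
    arc? : ∀ a b → Dec (Arc G a b)

module Automorphisms (F : FiniteDigraph G) where
  open FiniteDigraph F

  InverseHomomorphisms : (Vtx G → Vtx G) → (Vtx G → Vtx G) → Set
  InverseHomomorphisms f g = (∀ x → g (f x) ≡ x) × (∀ x → f (g x) ≡ x) ×
                             (∀ a b → Arc G a b → Arc G (f a) (f b)) × (∀ a b → Arc G a b → Arc G (g a) (g b))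

  inverseHomomorphisms? : ∀ f g → Dec (InverseHomomorphisms f g)
  inverseHomomorphisms? f g =
    all? (λ x → g (f x) ≟ x) ×-dec all? (λ x → f (g x) ≟ x) ×-dec
    all? (λ a → all? λ b → arc? a b →-dec arc? (f a) (f b)) ×-dec
    all? (λ a → all? λ b → arc? a b →-dec arc? (g a) (g b))

  automorphism : ∀ f g → InverseHomomorphisms f g → Aut G
  automorphism f g (gf , fg , hom-f , hom-g) = record
    { σ = f ; σ⁻¹ = g ; invˡ = gf ; invʳ = fg
    ; pres = λ a b → hom-f a b , λ r → subst₂ (Arc G) (gf a) (gf b) (hom-g _ _ r) }

  firstSending : List (Aut G) → Vtx G → Vtx G → Aut G
  firstSending []       x y = idᴬ
  firstSending (α ∷ αs) x y = if does (σ α x ≟ y) then α else firstSending αs x y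

module Embeddings (FG : FiniteDigraph G) (FH : FiniteDigraph H) where
  open FiniteDigraph

  IsEmbedding : (Vtx H → Vtx G) → Set
  IsEmbedding e = (∀ i j → e i ≡ e j → i ≡ j) × (∀ i j → Arc H i j → Arc G (e i) (e j))

  isEmbedding? : ∀ e → Dec (IsEmbedding e)
  isEmbedding? e =
    all? FH (λ i → all? FH λ j → _≟_ FG (e i) (e j) →-dec _≟_ FH i j) ×-dec
    all? FH (λ i → all? FH λ j → arc? FH i j →-dec arc? FG (e i) (e j))

  copy : ∀ e → IsEmbedding e → Copy G H
  copy e (inj , hom) = record { emb = e ; inj = inj ; hom = hom }

  InV? : (c : Copy G H) → ∀ x → Dec (InV c x)
  InV? c x = any? FH λ i → _≟_ FG (emb c i) x

  InA? : (c : Copy G H) → ∀ a b → Dec (InA c a b)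
  InA? c a b = any? FH λ i → any? FH λ j →
    arc? FH i j ×-dec _≟_ FG (emb c i) a ×-dec _≟_ FG (emb c j) b

copySetoid : Digraph → Digraph → Setoid 0ℓ 0ℓ
copySetoid G H = record
  { Carrier = Copy G H
  ; _≈_ = SameCopy
  ; isEquivalence = record
    { refl  = (λ _ → ⇔′-refl) , (λ _ _ → ⇔′-refl)
    ; sym   = λ (sv , sa) → (λ x → ⇔′-sym (sv x)) , (λ a b → ⇔′-sym (sa a b))
    ; trans = λ (sv , sa) (tv , ta) → (λ x → ⇔′-trans (sv x) (tv x)) , (λ a b → ⇔′-trans (sa a b) (ta a b))
    } }

module SameCopy-Reasoning {G H : Digraph} = SetoidReasoning (copySetoid G H)

SameCopy-pointwise : (c d : Copy G H) → (∀ i → emb c i ≡ emb d i) → SameCopy c d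
SameCopy-pointwise c d h =
  (λ x → (λ { (i , p) → i , trans (sym (h i)) p }) , (λ { (i , p) → i , trans (h i) p })) ,
  (λ a b → (λ { (i , j , r , p , q) → i , j , r , trans (sym (h i)) p , trans (sym (h j)) q }) ,
           (λ { (i , j , r , p , q) → i , j , r , trans (h i) p , trans (h j) q }))

mapCopy : Aut G → Copy G H → Copy G H
mapCopy α c = record
  { emb = λ i → σ α (emb c i)
  ; inj = λ i j p → inj c i j (σ-injective α p)
  ; hom = λ i j r → proj₁ (pres α _ _) (hom c i j r) }

distinct : (c : Copy G H) {i j : Vtx H} → ¬ i ≡ j → ¬ emb c i ≡ emb c j
distinct c i≢j p = i≢j (inj c _ _ p)

mapCopy-inverse : (α : Aut G) (c : Copy G H) → SameCopy (mapCopy (α ⁻¹ᴬ) (mapCopy α c)) c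
mapCopy-inverse α c = SameCopy-pointwise (mapCopy (α ⁻¹ᴬ) (mapCopy α c)) c λ i → invˡ α (emb c i)

InV-map : (α : Aut G) (c : Copy G H) → ∀ y → InV (mapCopy α c) y ⇔′ InV c (σ⁻¹ α y)
InV-map α c y = (λ { (i , p) → i , sym (σ⁻¹-from α p) }) ,
                (λ { (i , p) → i , trans (cong (σ α) p) (invʳ α y) })

InA-map : (α : Aut G) (c : Copy G H) → ∀ a b → InA (mapCopy α c) a b ⇔′ InA c (σ⁻¹ α a) (σ⁻¹ α b)
InA-map α c a b =
  (λ { (i , j , r , p , q) → i , j , r , sym (σ⁻¹-from α p) , sym (σ⁻¹-from α q) }) ,
  (λ { (i , j , r , p , q) → i , j , r , trans (cong (σ α) p) (invʳ α a) , trans (cong (σ α) q) (invʳ α b) })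

SameCopy-map : (α : Aut G) (c d : Copy G H) → SameCopy c d → SameCopy (mapCopy α c) (mapCopy α d)
SameCopy-map α c d (sv , sa) =
  (λ y → ⇔′-trans (InV-map α c y) (⇔′-trans (sv _) (⇔′-sym (InV-map α d y)))) ,
  (λ a b → ⇔′-trans (InA-map α c a b) (⇔′-trans (sa _ _) (⇔′-sym (InA-map α d a b))))

SameCopy-unmap : (α : Aut G) (c d : Copy G H) → SameCopy (mapCopy α c) d → SameCopy (mapCopy (α ⁻¹ᴬ) d) c
SameCopy-unmap α c d s = begin
  mapCopy (α ⁻¹ᴬ) d             ≈⟨ SameCopy-map (α ⁻¹ᴬ) (mapCopy α c) d s ⟨
  mapCopy (α ⁻¹ᴬ) (mapCopy α c) ≈⟨ mapCopy-inverse α c ⟩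
  c                             ∎
  where open SameCopy-Reasoning

reindex : Aut H → Copy G H → Copy G H
reindex π c = record
  { emb = λ i → emb c (σ π i)
  ; inj = λ i j p → σ-injective π (inj c _ _ p)
  ; hom = λ i j r → hom c _ _ (proj₁ (pres π i j) r) }

reindex-same : (π : Aut H) (c : Copy G H) → SameCopy (reindex π c) c
reindex-same π c =
  (λ x → (λ { (i , p) → σ π i , p }) ,
         (λ { (i , p) → σ⁻¹ π i , trans (cong (emb c) (invʳ π i)) p })) ,
  (λ a b → (λ { (i , j , r , p , q) → σ π i , σ π j , proj₁ (pres π i j) r , p , q }) ,
           (λ { (i , j , r , p , q) → σ⁻¹ π i , σ⁻¹ π j , proj₁ (pres (π ⁻¹ᴬ) i j) r
                                     , trans (cong (emb c) (invʳ π i)) p , trans (cong (emb c) (invʳ π j)) q }))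

isomorphism⇒automorphism : (c d : Copy G H) (φ : Vtx G → Vtx G) → IsIso c d φ →
                           Σ (Aut H) λ π → ∀ i → φ (emb c i) ≡ emb d (σ π i)
isomorphism⇒automorphism {H = H} c d φ iso = π , λ i → sym (proj₂ (image i))
  where
  open IsIso iso

  image : ∀ i → ∃ λ j → emb d j ≡ φ (emb c i)
  image i = maps (emb c i) (i , refl)

  preimage : ∀ j → ∃ λ i → φ (emb c i) ≡ emb d j
  preimage j with surj (emb d j) (j , refl)
  ... | _ , (i , refl) , p = i , p

  forth back : Vtx H → Vtx H
  forth i = proj₁ (image i)
  back j = proj₁ (preimage j)

  forth-arc : ∀ i j → Arc H i j → Arc H (forth i) (forth j)
  forth-arc i j r with proj₁ (arcs _ _ (i , refl) (j , refl)) (i , j , r , refl , refl)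
  ... | i′ , j′ , r′ , p , q =
    subst₂ (Arc H) (inj d _ _ (trans p (sym (proj₂ (image i)))))
                   (inj d _ _ (trans q (sym (proj₂ (image j))))) r′

  back-arc : ∀ i j → Arc H (forth i) (forth j) → Arc H i j
  back-arc i j r with proj₂ (arcs _ _ (i , refl) (j , refl)) (forth i , forth j , r , proj₂ (image i) , proj₂ (image j))
  ... | i′ , j′ , r′ , p , q = subst₂ (Arc H) (inj c _ _ p) (inj c _ _ q) r′

  π : Aut H
  π = record
    { σ = forth ; σ⁻¹ = back
    ; invˡ = λ i → inj c _ _ (injV _ _ (_ , refl) (i , refl)
                                   (trans (proj₂ (preimage (forth i))) (proj₂ (image i))))
    ; invʳ = λ j → inj d _ _ (trans (proj₂ (image (back j))) (proj₂ (preimage j)))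
    ; pres = λ i j → forth-arc i j , back-arc i j }

CopyTransitive : (G H : Digraph) → (Vtx H → Vtx G) → Set
CopyTransitive G H base = (c : Copy G H) → Σ (Aut G) λ α → ∀ i → σ α (emb c i) ≡ base i

copyTransitive⇒UH : (base : Vtx H → Vtx G) → CopyTransitive G H base → UH G H
copyTransitive⇒UH {H = H} {G = G} base move c d φ iso = αd ⁻¹ᴬ ∘ᴬ αc , agrees
  where
  π : Aut H
  π = proj₁ (isomorphism⇒automorphism c d φ iso)
  αc αd : Aut G
  αc = proj₁ (move c)
  αd = proj₁ (move (reindex π d))

  agrees : ∀ x → InV c x → σ (αd ⁻¹ᴬ ∘ᴬ αc) x ≡ φ x
  agrees _ (i , refl) = begin
    σ⁻¹ αd (σ αc (emb c i)) ≡⟨ cong (σ⁻¹ αd) (proj₂ (move c) i) ⟩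
    σ⁻¹ αd (base i)         ≡⟨ σ⁻¹-from αd (proj₂ (move (reindex π d)) i) ⟩
    emb d (σ π i)           ≡⟨ proj₂ (isomorphism⇒automorphism c d φ iso) i ⟨
    φ (emb c i)             ∎
    where open ≡-Reasoning

HasUniquePartner : Copy G H → Copy G M → Set
HasUniquePartner {G = G} {H = H} H₀ M₀ =
  Σ (Copy G H) λ H₁ → Partner H₀ M₀ H₁ × ((H₂ : Copy G H) → Partner H₀ M₀ H₂ → SameCopy H₁ H₂)

Partner-resp : (H₀ H₀′ : Copy G H) (M₀ M₀′ : Copy G M) (H₁ : Copy G H) →
               SameCopy H₀ H₀′ → SameCopy M₀ M₀′ → Partner H₀ M₀ H₁ → Partner H₀′ M₀′ H₁
Partner-resp H₀ H₀′ M₀ M₀′ H₁ s₀ sₘ (different , meetV , meetA) =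
  (λ s → different (begin H₀ ≈⟨ s₀ ⟩ H₀′ ≈⟨ s ⟩ H₁ ∎)) ,
  (λ x → ⇔′-trans (⇔′-sym (proj₁ s₀ x) ×-⇔′ ⇔′-refl) (⇔′-trans (meetV x) (proj₁ sₘ x))) ,
  (λ a b → ⇔′-trans (⇔′-sym (proj₂ s₀ a b) ×-⇔′ ⇔′-refl) (⇔′-trans (meetA a b) (proj₂ sₘ a b)))
  where open SameCopy-Reasoning

Partner-map : (α : Aut G) (H₀ : Copy G H) (M₀ : Copy G M) (H₁ : Copy G H) →
              Partner H₀ M₀ H₁ → Partner (mapCopy α H₀) (mapCopy α M₀) (mapCopy α H₁)
Partner-map α H₀ M₀ H₁ (different , meetV , meetA) =
  (λ s → different (begin
     H₀                             ≈⟨ mapCopy-inverse α H₀ ⟨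
     mapCopy (α ⁻¹ᴬ) (mapCopy α H₀) ≈⟨ SameCopy-map (α ⁻¹ᴬ) (mapCopy α H₀) (mapCopy α H₁) s ⟩
     mapCopy (α ⁻¹ᴬ) (mapCopy α H₁) ≈⟨ mapCopy-inverse α H₁ ⟩
     H₁                             ∎)) ,
  (λ y → ⇔′-trans (InV-map α H₀ y ×-⇔′ InV-map α H₁ y)
                  (⇔′-trans (meetV _) (⇔′-sym (InV-map α M₀ y)))) ,
  (λ a b → ⇔′-trans (InA-map α H₀ a b ×-⇔′ InA-map α H₁ b a)
                    (⇔′-trans (meetA _ _) (⇔′-sym (InA-map α M₀ a b))))
  where open SameCopy-Reasoning

hasUniquePartner-transport : (α : Aut G) (H₀ H₀′ : Copy G H) (M₀ M₀′ : Copy G M) →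
  SameCopy (mapCopy α H₀) H₀′ → SameCopy (mapCopy α M₀) M₀′ →
  HasUniquePartner H₀′ M₀′ → HasUniquePartner H₀ M₀
hasUniquePartner-transport α H₀ H₀′ M₀ M₀′ sH sM (H₁ , partner , unique) =
  mapCopy (α ⁻¹ᴬ) H₁ , pulled-back , unique′
  where
  open SameCopy-Reasoning

  pulled-back : Partner H₀ M₀ (mapCopy (α ⁻¹ᴬ) H₁)
  pulled-back = Partner-resp (mapCopy (α ⁻¹ᴬ) H₀′) H₀ (mapCopy (α ⁻¹ᴬ) M₀′) M₀ (mapCopy (α ⁻¹ᴬ) H₁)
                  (SameCopy-unmap α H₀ H₀′ sH) (SameCopy-unmap α M₀ M₀′ sM) (Partner-map (α ⁻¹ᴬ) H₀′ M₀′ H₁ partner)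

  unique′ : (H₂ : Copy _ _) → Partner H₀ M₀ H₂ → SameCopy (mapCopy (α ⁻¹ᴬ) H₁) H₂
  unique′ H₂ p = begin
    mapCopy (α ⁻¹ᴬ) H₁             ≈⟨ SameCopy-map (α ⁻¹ᴬ) H₁ (mapCopy α H₂) (unique (mapCopy α H₂) pushed) ⟩
    mapCopy (α ⁻¹ᴬ) (mapCopy α H₂) ≈⟨ mapCopy-inverse α H₂ ⟩
    H₂                             ∎
    where
    pushed : Partner H₀′ M₀′ (mapCopy α H₂)
    pushed = Partner-resp (mapCopy α H₀) H₀′ (mapCopy α M₀) M₀′ (mapCopy α H₂) sH sM (Partner-map α H₀ M₀ H₂ p)

C⃗₇-finite : FiniteDigraph C⃗₇
C⃗₇-finite = record { all? = Fin.all? ; any? = Fin.any? ; _≟_ = Fin._≟_ ; arc? = λ i j → j Fin.≟ i +₇ 1 }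

P⃗₃-finite : FiniteDigraph P⃗₃
P⃗₃-finite = record { all? = Fin.all? ; any? = Fin.any? ; _≟_ = Fin._≟_ ; arc? = λ i j → toℕ j ℕ.≟ suc (toℕ i) }

cycle-arc : (c : Copy G C⃗₇) (i : Fin 7) → Arc G (emb c i) (emb c (i +₇ 1))
cycle-arc c i = hom c i (i +₇ 1) refl

rotation : Fin 7 → Aut C⃗₇
rotation j = successor ^ᴬ toℕ j
  where
  open Automorphisms C⃗₇-finite
  successor : Aut C⃗₇
  successor = automorphism (_+₇ 1) (_+₇ 6) (from-yes (inverseHomomorphisms? (_+₇ 1) (_+₇ 6)))

rotation-start : ∀ j →
  σ (rotation j) (# 0) ≡ j × σ (rotation j) (# 1) ≡ j +₇ 1 × σ (rotation j) (# 2) ≡ (j +₇ 1) +₇ 1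
rotation-start = from-yes (Fin.all? λ j →
  (σ (rotation j) (# 0) Fin.≟ j) ×-dec (σ (rotation j) (# 1) Fin.≟ j +₇ 1) ×-dec
  (σ (rotation j) (# 2) Fin.≟ (j +₇ 1) +₇ 1))

consecutive-arcs : (c : Copy G C⃗₇) {a b b′ : Vtx G} → InA c a b → InA c b b′ →
  ∃ λ j → emb c j ≡ a × emb c (j +₇ 1) ≡ b × emb c ((j +₇ 1) +₇ 1) ≡ b′
consecutive-arcs c (i , _ , refl , ia , ib) (k , _ , refl , kb , kb′)
  with inj c k (i +₇ 1) (trans kb (sym ib))
... | refl = i , ia , ib , kb′

rotate-to-2-arc : (c : Copy G C⃗₇) {a b b′ : Vtx G} → InA c a b → InA c b b′ →
  Σ (Copy G C⃗₇) λ r → SameCopy r c × emb r (# 0) ≡ a × emb r (# 1) ≡ b × emb r (# 2) ≡ b′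
rotate-to-2-arc c ab bb′ =
  let (j , ja , jb , jb′) = consecutive-arcs c ab bb′
      (s₀ , s₁ , s₂) = rotation-start j
  in reindex (rotation j) c , reindex-same (rotation j) c ,
     trans (cong (emb c) s₀) ja , trans (cong (emb c) s₁) jb , trans (cong (emb c) s₂) jb′

_≟ᴷ_ : DecidableEquality Kind
u ≟ᴷ u = yes refl
u ≟ᴷ v = no λ ()
u ≟ᴷ t = no λ ()
u ≟ᴷ z = no λ ()
v ≟ᴷ u = no λ ()
v ≟ᴷ v = yes refl
v ≟ᴷ t = no λ ()
v ≟ᴷ z = no λ ()
t ≟ᴷ u = no λ ()
t ≟ᴷ v = no λ ()
t ≟ᴷ t = yes refl
t ≟ᴷ z = no λ ()
z ≟ᴷ u = no λ ()
z ≟ᴷ v = no λ ()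
z ≟ᴷ t = no λ ()
z ≟ᴷ z = yes refl

all-Kind? : {P : Kind → Set} → U.Decidable P → Dec (∀ k → P k)
all-Kind? P? = map′ (λ { (pu , pv , pt , pz) → λ { u → pu ; v → pv ; t → pt ; z → pz } })
                    (λ p → p u , p v , p t , p z)
                    (P? u ×-dec P? v ×-dec P? t ×-dec P? z)

any-Kind? : {P : Kind → Set} → U.Decidable P → Dec (∃ P)
any-Kind? P? = map′ [ (u ,_) , [ (v ,_) , [ (t ,_) , (z ,_) ]′ ]′ ]′
                    (λ { (u , p) → inj₁ p ; (v , p) → inj₂ (inj₁ p) ; (t , p) → inj₂ (inj₂ (inj₁ p))
                       ; (z , p) → inj₂ (inj₂ (inj₂ p)) })
                    (P? u ⊎-dec P? v ⊎-dec P? t ⊎-dec P? z)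

edge? : ∀ a b → Dec (CoxEdge a b)
edge? (u , i) (u , j) = map′ (λ { refl → uu i }) (λ { (uu _) → refl }) (j Fin.≟ i +₇ 1)
edge? (v , i) (v , j) = map′ (λ { refl → vv i }) (λ { (vv _) → refl }) (j Fin.≟ i +₇ 2)
edge? (t , i) (t , j) = map′ (λ { refl → tt i }) (λ { (tt _) → refl }) (j Fin.≟ i +₇ 3)
edge? (z , i) (u , j) = map′ (λ { refl → zu i }) (λ { (zu _) → refl }) (j Fin.≟ i)
edge? (z , i) (v , j) = map′ (λ { refl → zv i }) (λ { (zv _) → refl }) (j Fin.≟ i)
edge? (z , i) (t , j) = map′ (λ { refl → zt i }) (λ { (zt _) → refl }) (j Fin.≟ i)
edge? (u , _) (v , _) = no λ ()
edge? (u , _) (t , _) = no λ ()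
edge? (u , _) (z , _) = no λ ()
edge? (v , _) (u , _) = no λ ()
edge? (v , _) (t , _) = no λ ()
edge? (v , _) (z , _) = no λ ()
edge? (t , _) (u , _) = no λ ()
edge? (t , _) (v , _) = no λ ()
edge? (t , _) (z , _) = no λ ()
edge? (z , _) (z , _) = no λ ()

Coxeter-finite : FiniteDigraph Coxeter
Coxeter-finite = record
  { all? = λ P? → map′ (λ p (k , i) → p k i) (λ p k i → p (k , i))
                       (all-Kind? λ k → Fin.all? λ i → P? (k , i))
  ; any? = λ P? → map′ (λ (k , i , p) → (k , i) , p) (λ ((k , i) , p) → k , i , p)
                       (any-Kind? λ k → Fin.any? λ i → P? (k , i))
  ; _≟_  = ≡-dec _≟ᴷ_ Fin._≟_
  ; arc? = λ a b → edge? a b ⊎-dec edge? b a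
  }

open FiniteDigraph Coxeter-finite using (_≟_; arc?) renaming (all? to ∀ᵛ?)
open Automorphisms Coxeter-finite

CoxArc : CoxV → CoxV → Set
CoxArc = Arc Coxeter

shift : CoxV → CoxV
shift (k , i) = k , i +₇ 1

unshift : CoxV → CoxV
unshift (k , i) = k , i +₇ 6

negate : CoxV → CoxV
negate (k , i) = k , (7 ∸ toℕ i) mod 7

double : Fin 7 → Fin 7
double i = i +₇ toℕ i

twist : CoxV → CoxV
twist (u , i) = v , double i
twist (v , i) = t , double i
twist (t , i) = u , double i
twist (z , i) = z , double i

untwist : CoxV → CoxV
untwist (u , i) = t , double (double i)
untwist (v , i) = u , double (double i)
untwist (t , i) = v , double (double i)
untwist (z , i) = z , double (double i)

swap : CoxV → CoxV
swap (k , i) = lookup (row k) i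
  where
  row : Kind → Vec CoxV 7
  row u = (u , # 0) ∷ᵥ (u , # 1) ∷ᵥ (u , # 2) ∷ᵥ (z , # 2) ∷ᵥ (v , # 2) ∷ᵥ (v , # 0) ∷ᵥ (z , # 0) ∷ᵥ []ᵥ
  row v = (u , # 5) ∷ᵥ (t , # 1) ∷ᵥ (u , # 4) ∷ᵥ (t , # 5) ∷ᵥ (z , # 4) ∷ᵥ (z , # 5) ∷ᵥ (t , # 4) ∷ᵥ []ᵥ
  row t = (z , # 6) ∷ᵥ (v , # 1) ∷ᵥ (z , # 3) ∷ᵥ (t , # 6) ∷ᵥ (v , # 6) ∷ᵥ (v , # 3) ∷ᵥ (t , # 3) ∷ᵥ []ᵥ
  row z = (u , # 6) ∷ᵥ (z , # 1) ∷ᵥ (u , # 3) ∷ᵥ (t , # 2) ∷ᵥ (v , # 4) ∷ᵥ (v , # 5) ∷ᵥ (t , # 0) ∷ᵥ []ᵥ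

ρ ι μ κ : Aut Coxeter
ρ = automorphism shift unshift (from-yes (inverseHomomorphisms? shift unshift))
ι = automorphism negate negate (from-yes (inverseHomomorphisms? negate negate))
μ = automorphism twist untwist (from-yes (inverseHomomorphisms? twist untwist))
κ = automorphism swap swap (from-yes (inverseHomomorphisms? swap swap))

-- ρ⁻ⁱ moves the i-th vertex of a cycle to index 0; then μ², μ and ρκ move v₀, t₀ and z₀ to u₀
toU₀ : CoxV → Aut Coxeter
toU₀ (u , i) = ρ ⁻¹ᴬ ^ᴬ toℕ i
toU₀ (v , i) = μ ∘ᴬ μ ∘ᴬ ρ ⁻¹ᴬ ^ᴬ toℕ i
toU₀ (t , i) = μ ∘ᴬ ρ ⁻¹ᴬ ^ᴬ toℕ i
toU₀ (z , i) = ρ ∘ᴬ κ ∘ᴬ ρ ⁻¹ᴬ ^ᴬ toℕ i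

-- ι and ικ fix u₀ and send u₆ and z₀ to u₁; κ′, the conjugate of κ by the reflection i ↦ 1 − i,
-- fixes u₀ and u₁ and sends z₁ to u₂; κ fixes u₀, u₁, u₂ and sends z₂ to u₃.
normalise₂ : CoxV → CoxV → CoxV → Aut Coxeter
normalise₂ x₀ x₁ x₂ = firstSending (idᴬ ∷ κ′ ∷ []) (σ α₁ x₂) (u , # 2) ∘ᴬ α₁
  where
  α₀ α₁ κ′ : Aut Coxeter
  α₀ = toU₀ x₀
  α₁ = firstSending (idᴬ ∷ ι ∷ ι ∘ᴬ κ ∷ []) (σ α₀ x₁) (u , # 1) ∘ᴬ α₀
  κ′ = (ρ ∘ᴬ ι) ∘ᴬ κ ∘ᴬ (ρ ∘ᴬ ι)

normalise₃ : CoxV → CoxV → CoxV → CoxV → Aut Coxeter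
normalise₃ x₀ x₁ x₂ x₃ = firstSending (idᴬ ∷ κ ∷ []) (σ α x₃) (u , # 3) ∘ᴬ α
  where
  α : Aut Coxeter
  α = normalise₂ x₀ x₁ x₂

normalise₂-correct : ∀ x₀ x₁ → CoxArc x₀ x₁ → ∀ x₂ → CoxArc x₁ x₂ → ¬ x₂ ≡ x₀ →
  let α = normalise₂ x₀ x₁ x₂ in σ α x₀ ≡ (u , # 0) × σ α x₁ ≡ (u , # 1) × σ α x₂ ≡ (u , # 2)
normalise₂-correct = from-yes
  (∀ᵛ? λ x₀ → ∀ᵛ? λ x₁ → arc? x₀ x₁ →-dec ∀ᵛ? λ x₂ → arc? x₁ x₂ →-dec ¬? (x₂ ≟ x₀) →-dec
    let α = normalise₂ x₀ x₁ x₂ in (σ α x₀ ≟ (u , # 0)) ×-dec (σ α x₁ ≟ (u , # 1)) ×-dec (σ α x₂ ≟ (u , # 2)))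

normalise₃-correct : ∀ x₀ x₁ → CoxArc x₀ x₁ → ∀ x₂ → CoxArc x₁ x₂ → ¬ x₂ ≡ x₀ → ∀ x₃ → CoxArc x₂ x₃ → ¬ x₃ ≡ x₁ →
  let α = normalise₃ x₀ x₁ x₂ x₃
  in σ α x₀ ≡ (u , # 0) × σ α x₁ ≡ (u , # 1) × σ α x₂ ≡ (u , # 2) × σ α x₃ ≡ (u , # 3)
normalise₃-correct = from-yes
  (∀ᵛ? λ x₀ → ∀ᵛ? λ x₁ → arc? x₀ x₁ →-dec ∀ᵛ? λ x₂ → arc? x₁ x₂ →-dec ¬? (x₂ ≟ x₀) →-dec
   ∀ᵛ? λ x₃ → arc? x₂ x₃ →-dec ¬? (x₃ ≟ x₁) →-dec
    let α = normalise₃ x₀ x₁ x₂ x₃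
    in (σ α x₀ ≟ (u , # 0)) ×-dec (σ α x₁ ≟ (u , # 1)) ×-dec (σ α x₂ ≟ (u , # 2)) ×-dec (σ α x₃ ≟ (u , # 3)))

closed-walk-from-u₀u₁u₂u₃ : ∀ x₄ → CoxArc (u , # 3) x₄ → ∀ x₅ → CoxArc x₄ x₅ → ∀ x₆ → CoxArc x₅ x₆ → CoxArc x₆ (u , # 0) →
  x₄ ≡ (u , # 4) × x₅ ≡ (u , # 5) × x₆ ≡ (u , # 6)
closed-walk-from-u₀u₁u₂u₃ = from-yes
  (∀ᵛ? λ x₄ → arc? (u , # 3) x₄ →-dec ∀ᵛ? λ x₅ → arc? x₄ x₅ →-dec ∀ᵛ? λ x₆ → arc? x₅ x₆ →-dec arc? x₆ (u , # 0) →-dec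
    (x₄ ≟ (u , # 4)) ×-dec (x₅ ≟ (u , # 5)) ×-dec (x₆ ≟ (u , # 6)))

open Embeddings Coxeter-finite C⃗₇-finite using (InV?; InA?) renaming (copy to cycle; isEmbedding? to isCycle?)
open Embeddings Coxeter-finite P⃗₃-finite using () renaming (copy to 2-arc; isEmbedding? to is2-arc?; InV? to InV₃?; InA? to InA₃?)

uCycle : Copy Coxeter C⃗₇
uCycle = cycle (u ,_) (from-yes (isCycle? (u ,_)))

u₀u₁u₂ : Copy Coxeter P⃗₃
u₀u₁u₂ = 2-arc (λ k → u , k Fin.↑ˡ 4) (from-yes (is2-arc? λ k → u , k Fin.↑ˡ 4))

partnerCycle : Copy Coxeter C⃗₇
partnerCycle = cycle vertex (from-yes (isCycle? vertex))
  where
  vertex : Fin 7 → CoxV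
  vertex = lookup ((u , # 2) ∷ᵥ (u , # 1) ∷ᵥ (u , # 0) ∷ᵥ (z , # 0) ∷ᵥ (v , # 0) ∷ᵥ (v , # 2) ∷ᵥ (z , # 2) ∷ᵥ []ᵥ)

-- Without the avoidance hypothesis the reversed u-cycle u₂u₁u₀u₆u₅u₄u₃ would also qualify.
closed-walk-from-u₂u₁u₀ : ∀ x₃ → CoxArc (u , # 0) x₃ → (InV uCycle x₃ → InV u₀u₁u₂ x₃) →
  ∀ x₄ → CoxArc x₃ x₄ → ∀ x₅ → CoxArc x₄ x₅ → ∀ x₆ → CoxArc x₅ x₆ → CoxArc x₆ (u , # 2) →
  x₃ ≡ (z , # 0) × x₄ ≡ (v , # 0) × x₅ ≡ (v , # 2) × x₆ ≡ (z , # 2)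
closed-walk-from-u₂u₁u₀ = from-yes
  (∀ᵛ? λ x₃ → arc? (u , # 0) x₃ →-dec (InV? uCycle x₃ →-dec InV₃? u₀u₁u₂ x₃) →-dec
   ∀ᵛ? λ x₄ → arc? x₃ x₄ →-dec ∀ᵛ? λ x₅ → arc? x₄ x₅ →-dec ∀ᵛ? λ x₆ → arc? x₅ x₆ →-dec arc? x₆ (u , # 2) →-dec
    (x₃ ≟ (z , # 0)) ×-dec (x₄ ≟ (v , # 0)) ×-dec (x₅ ≟ (v , # 2)) ×-dec (x₆ ≟ (z , # 2)))

partnerCycle-isPartner : Partner uCycle u₀u₁u₂ partnerCycle
partnerCycle-isPartner =
  (λ (sameV , _) → case proj₂ (sameV (z , # 0)) (# 3 , refl) of λ { (_ , ()) }) ,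
  from-yes (∀ᵛ? λ x → (InV? uCycle x ×-dec InV? partnerCycle x) ⇔′? InV₃? u₀u₁u₂ x) ,
  from-yes (∀ᵛ? λ a → ∀ᵛ? λ b → (InA? uCycle a b ×-dec InA? partnerCycle b a) ⇔′? InA₃? u₀u₁u₂ a b)

cycle-through-u₀u₁u₂u₃ : (c : Copy Coxeter C⃗₇) →
  emb c (# 0) ≡ (u , # 0) → emb c (# 1) ≡ (u , # 1) → emb c (# 2) ≡ (u , # 2) → emb c (# 3) ≡ (u , # 3) →
  ∀ i → emb c i ≡ emb uCycle i
cycle-through-u₀u₁u₂u₃ c e₀ e₁ e₂ e₃ =
  let (e₄ , e₅ , e₆) = closed-walk-from-u₀u₁u₂u₃ _ (subst (λ x → CoxArc x (emb c (# 4))) e₃ (cycle-arc c (# 3)))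
                         _ (cycle-arc c (# 4)) _ (cycle-arc c (# 5)) (subst (CoxArc (emb c (# 6))) e₀ (cycle-arc c (# 6)))
  in Fin.∀-cons e₀ (Fin.∀-cons e₁ (Fin.∀-cons e₂ (Fin.∀-cons e₃ (Fin.∀-cons e₄ (Fin.∀-cons e₅ (Fin.∀-cons e₆ λ ()))))))

2-arcs-transitive : CopyTransitive Coxeter P⃗₃ (emb u₀u₁u₂)
2-arcs-transitive c =
  let (e₀ , e₁ , e₂) = normalise₂-correct _ _ (hom c (# 0) (# 1) refl) _ (hom c (# 1) (# 2) refl) (distinct c λ ())
  in normalise₂ (emb c (# 0)) (emb c (# 1)) (emb c (# 2)) , Fin.∀-cons e₀ (Fin.∀-cons e₁ (Fin.∀-cons e₂ λ ()))

cycles-transitive : CopyTransitive Coxeter C⃗₇ (emb uCycle)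
cycles-transitive c =
  let α = normalise₃ (emb c (# 0)) (emb c (# 1)) (emb c (# 2)) (emb c (# 3))
      (e₀ , e₁ , e₂ , e₃) = normalise₃-correct _ _ (cycle-arc c (# 0)) _ (cycle-arc c (# 1)) (distinct c λ ())
                                               _ (cycle-arc c (# 2)) (distinct c λ ())
  in α , cycle-through-u₀u₁u₂u₃ (mapCopy α c) e₀ e₁ e₂ e₃

uCycle-hasUniquePartner : HasUniquePartner uCycle u₀u₁u₂
uCycle-hasUniquePartner = partnerCycle , partnerCycle-isPartner , unique
  where
  unique : (H₂ : Copy Coxeter C⃗₇) → Partner uCycle u₀u₁u₂ H₂ → SameCopy partnerCycle H₂
  unique H₂ (_ , meetV , meetA) =
    let reversed : ∀ {a b} → InA u₀u₁u₂ a b → InA H₂ b a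
        reversed ab = proj₂ (proj₂ (meetA _ _) ab)
        (r , r≈H₂ , r₀ , r₁ , r₂) = rotate-to-2-arc H₂ (reversed (# 1 , # 2 , refl , refl , refl))
                                                      (reversed (# 0 , # 1 , refl , refl , refl))
        avoids : InV uCycle (emb r (# 3)) → InV u₀u₁u₂ (emb r (# 3))
        avoids p = proj₁ (meetV _) (p , proj₁ (proj₁ r≈H₂ _) (# 3 , refl))
        (e₃ , e₄ , e₅ , e₆) = closed-walk-from-u₂u₁u₀ _ (subst (λ x → CoxArc x (emb r (# 3))) r₂ (cycle-arc r (# 2))) avoids
                                _ (cycle-arc r (# 3)) _ (cycle-arc r (# 4)) _ (cycle-arc r (# 5))
                                (subst (CoxArc (emb r (# 6))) r₀ (cycle-arc r (# 6)))
        same : ∀ i → emb partnerCycle i ≡ emb r i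
        same = Fin.∀-cons (sym r₀) (Fin.∀-cons (sym r₁) (Fin.∀-cons (sym r₂) (Fin.∀-cons (sym e₃)
                 (Fin.∀-cons (sym e₄) (Fin.∀-cons (sym e₅) (Fin.∀-cons (sym e₆) λ ()))))))
    in begin partnerCycle ≈⟨ SameCopy-pointwise partnerCycle r same ⟩ r ≈⟨ r≈H₂ ⟩ H₂ ∎
    where open SameCopy-Reasoning

cycles-haveUniquePartners : (H₀ : Copy Coxeter C⃗₇) (M₀ : Copy Coxeter P⃗₃) → M₀ ⊑ H₀ → HasUniquePartner H₀ M₀
cycles-haveUniquePartners H₀ M₀ (_ , arcs) =
  let (r , r≈H₀ , r₀ , r₁ , r₂) = rotate-to-2-arc H₀ (arcs _ _ (# 0 , # 1 , refl , refl , refl))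
                                                    (arcs _ _ (# 1 , # 2 , refl , refl , refl))
      (α , αr) = cycles-transitive r
      moved : ∀ k → σ α (emb M₀ k) ≡ emb u₀u₁u₂ k
      moved = Fin.∀-cons (trans (cong (σ α) (sym r₀)) (αr (# 0)))
                (Fin.∀-cons (trans (cong (σ α) (sym r₁)) (αr (# 1)))
                  (Fin.∀-cons (trans (cong (σ α) (sym r₂)) (αr (# 2))) λ ()))
  in hasUniquePartner-transport α H₀ uCycle M₀ u₀u₁u₂
       (begin mapCopy α H₀ ≈⟨ SameCopy-map α r H₀ r≈H₀ ⟨ mapCopy α r ≈⟨ SameCopy-pointwise (mapCopy α r) uCycle αr ⟩ uCycle ∎)
       (SameCopy-pointwise (mapCopy α M₀) u₀u₁u₂ moved)
       uCycle-hasUniquePartner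
  where open SameCopy-Reasoning

theorem2 : SetUH Coxeter C⃗₇ P⃗₃
theorem2 = copyTransitive⇒UH (emb u₀u₁u₂) 2-arcs-transitive ,
           copyTransitive⇒UH (emb uCycle) cycles-transitive ,
           cycles-haveUniquePartners
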